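{- In the theory ZFP described in the context, the following are theorems: (1) Unordered pairing: $\forall a,b:\exists x:\forall c:(c\in x\leftrightarrow(c=a\vee c=b))$. (2) Specification: for every formula $\varphi$ whose only possible free variable is $a$, $\forall_{\mathsf{Set}}x:\exists_{\mathsf{Set}}y:\forall a:(a\in y\leftrightarrow(a\in x\wedge\varphi))$. (3) Cartesian product existence: $\forall_{\mathsf{Set}}x,y:\exists_{\mathsf{Set}}z:\forall p:(p\in z\leftrightarrow(\exists a\in x:\exists b\in y:(a\,\pi_1\,p\wedge b\,\pi_2\,p)))$.
   Context: ZFP is a first-order theory with equality and binary predicate symbols $\in$, $\pi_1$, $\pi_2$ ("$b\,\pi_1\,p$" reads "$b$ is the first projection of $p$"). Terms include definite descriptions $(\iota x:\varphi)$, denoting the unique $x$ satisfying $\varphi$ if it exists, and otherwise a value $\bot$ making every atomic formula containing it false. Abbreviations: $\forall b\in X:\varphi:=\forall b:(b\in X\to\varphi)$, $\exists b\in X:\varphi:=\exists b:(b\in X\wedge\varphi)$; $\mathsf{Pair}(Q):=\exists b:\,b\,\pi_1\,Q$; $\mathsf{Set}(X):=\neg\mathsf{Pair}(X)$; $\forall_{\mathsf{Set}}x:\varphi:=\forall x:(\mathsf{Set}(x)\to\varphi)$; $\exists_{\mathsf{Set}}x:\varphi:=\exists x:(\mathsf{Set}(x)\wedge\varphi)$; $\forall_{\mathsf{Pair}}p:\varphi:=\forall p:(\mathsf{Pair}(p)\to\varphi)$; $X\subseteq Y:=\mathsf{Set}(X)\wedge\mathsf{Set}(Y)\wedge\forall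 c\in X:c\in Y$; $\emptyset:=\iota x:(\mathsf{Set}(x)\wedge\forall a:a\notin x)$. Axioms of ZFP: all instances, for every formula $\varphi$ with free variables among $a,b,c_1,c_2$, of: (S1) $\forall_{\mathsf{Set}}x,y:(\forall a: a\in x\leftrightarrow a\in y)\to x=y$; (S2) $\forall_{\mathsf{Set}}x:\exists y:\forall a:(a\in y\leftrightarrow \exists z\in x: a\in z)$; (S3) $\forall_{\mathsf{Set}}x:\exists y:\forall z:(z\in y\leftrightarrow z\subseteq x)$; (S4) $\exists y: (\exists_{\mathsf{Set}} z:(z\in y\wedge \forall b: b\notin z))\wedge(\forall x\in y:\exists s\in y:\forall c:(c\in s\leftrightarrow(c\in x\vee c=x)))$; (S5) $\forall c_1,c_2,x:(\forall a\in x:\exists! b:\varphi)\to(\exists_{\mathsf{Set}}y:\forall b:(b\in y\leftrightarrow\exists a\in x:\varphi))$; (S6) $\forall_{\mathsf{Set}}x: x=\emptyset\vee(\exists a\in x:\neg\exists b\in x:(b\,\pi_1\,a\vee b\,\pi_2\,a\vee b\in a))$; (P1) $\forall_{\mathsf{Pair}}p:\forall a: a\notin p$; (P2) $\forall a,b:\exists p:(a\,\pi_1\,p\wedge b\,\pi_2\,p)$; (P3) $\forall p:((\exists a: a\,\pi_1\,p)\leftrightarrow(\exists b: b\,\pi_2\,p))$; (P4) $\forall_{\mathsf{Pair}}p:(\exists! a: a\,\pi_1\,p)\wedge(\exists! b: b\,\pi_2\,p)$; (P5) $\forall_{\mathsf{Pair}}p,q:(\forall a:((a\,\pi_1\,p\leftrightarrow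 a\,\pi_1\,q)\wedge(a\,\pi_2\,p\leftrightarrow a\,\pi_2\,q)))\to p=q$. -}

module Defs where

open import Level using (0ℓ)
open import Data.Nat using (ℕ; zero; suc)
open import Data.Fin using (Fin; zero; suc)
open import Data.Product using (Σ; ∃; _×_; _,_)
open import Data.Sum using (_⊎_)
open import Data.Empty using (⊥)
open import Relation.Nullary using (¬_)
open import Relation.Binary.PropositionalEquality using (_≡_)

data Term : ℕ → Set
data Formula : ℕ → Set

data Term where
  var : ∀ {n} → Fin n → Term n
  ι   : ∀ {n} → Formula (suc n) → Term n   -- (ι x : φ), x = variable 0

data Formula where
  _∈'_ _π₁'_ _π₂'_ _≐_ : ∀ {n} → Term n → Term n → Formula n
  ⊥'   : ∀ {n} → Formula n
  ¬'_  : ∀ {n} → Formula n → Formula n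
  _∧'_ _∨'_ _⇒'_ _⇔'_ : ∀ {n} → Formula n → Formula n → Formula n
  ∀' ∃' : ∀ {n} → Formula (suc n) → Formula n

-- Structures (normal models: equality is interpreted as identity).

record Structure : Set₁ where
  field
    D    : Set
    _∈_  : D → D → Set
    _π₁_ : D → D → Set
    _π₂_ : D → D → Set

Env : Structure → ℕ → Set
Env M n = Fin n → Structure.D M


-- A description term (ι x : φ) denotes d iff d is the
-- unique object satisfying φ; if there is no such unique object it
-- denotes nothing (the value ⊥ of the paper), and then every atomic
-- formula containing it is false.
module Semantics (M : Structure) where
  open Structure M

  _∷ₑ_ : ∀ {n} → D → Env M n → Env M (suc n)
  (d ∷ₑ ρ) zero    = d
  (d ∷ₑ ρ) (suc i) = ρ i

  Denotes : ∀ {n} → Term n → Env M n → D → Set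
  ⟦_⟧     : ∀ {n} → Formula n → Env M n → Set

  atom : ∀ {n} → (D → D → Set) → Term n → Term n → Env M n → Set
  atom R t u ρ = Σ D λ d → Σ D λ e → Denotes t ρ d × Denotes u ρ e × R d e

  Denotes (var i) ρ d = ρ i ≡ d
  Denotes (ι φ)   ρ d = ⟦ φ ⟧ (d ∷ₑ ρ) × (∀ e → ⟦ φ ⟧ (e ∷ₑ ρ) → e ≡ d)

  ⟦ t ∈' u ⟧  ρ = atom _∈_ t u ρ
  ⟦ t π₁' u ⟧ ρ = atom _π₁_ t u ρ
  ⟦ t π₂' u ⟧ ρ = atom _π₂_ t u ρ
  ⟦ t ≐ u ⟧   ρ = atom _≡_ t u ρ
  ⟦ ⊥' ⟧      ρ = ⊥
  ⟦ ¬' φ ⟧    ρ = ¬ ⟦ φ ⟧ ρ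
  ⟦ φ ∧' ψ ⟧  ρ = ⟦ φ ⟧ ρ × ⟦ ψ ⟧ ρ
  ⟦ φ ∨' ψ ⟧  ρ = ⟦ φ ⟧ ρ ⊎ ⟦ ψ ⟧ ρ
  ⟦ φ ⇒' ψ ⟧  ρ = ⟦ φ ⟧ ρ → ⟦ ψ ⟧ ρ
  ⟦ φ ⇔' ψ ⟧  ρ = (⟦ φ ⟧ ρ → ⟦ ψ ⟧ ρ) × (⟦ ψ ⟧ ρ → ⟦ φ ⟧ ρ)
  ⟦ ∀' φ ⟧    ρ = ∀ d → ⟦ φ ⟧ (d ∷ₑ ρ)
  ⟦ ∃' φ ⟧    ρ = Σ D λ d → ⟦ φ ⟧ (d ∷ₑ ρ)

  env4 : D → D → D → D → Env M 4
  env4 a b c₁ c₂ zero                   = a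
  env4 a b c₁ c₂ (suc zero)             = b
  env4 a b c₁ c₂ (suc (suc zero))       = c₁
  env4 a b c₁ c₂ (suc (suc (suc zero))) = c₂

  env1 : D → Env M 1
  env1 a zero = a

  _∉_ : D → D → Set
  a ∉ x = ¬ (a ∈ x)

  _↔_ : Set → Set → Set
  P ↔ Q = (P → Q) × (Q → P)

  ∃!_ : (D → Set) → Set
  ∃! P = Σ D λ b → P b × (∀ b' → P b' → b' ≡ b)

  Pair : D → Set
  Pair Q = Σ D λ b → b π₁ Q

  IsSet : D → Set
  IsSet X = ¬ Pair X

  _⊆_ : D → D → Set
  X ⊆ Y = IsSet X × IsSet Y × (∀ c → c ∈ X → c ∈ Y)

  IsEmptySet : D → Set
  IsEmptySet x = IsSet x × (∀ a → a ∉ x)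

  -- "x = ∅" where ∅ := ι x:(Set(x) ∧ ∀a: a ∉ x): the description denotes
  -- d and x = d (false if ∅ does not denote).
  _≡∅ : D → Set
  x ≡∅ = Σ D λ d → (IsEmptySet d × (∀ e → IsEmptySet e → e ≡ d)) × x ≡ d

  record ZFP : Set₁ where
    field
      S1 : ∀ x y → IsSet x → IsSet y → (∀ a → (a ∈ x) ↔ (a ∈ y)) → x ≡ y
      S2 : ∀ x → IsSet x → Σ D λ y → ∀ a → (a ∈ y) ↔ (Σ D λ z → z ∈ x × a ∈ z)
      S3 : ∀ x → IsSet x → Σ D λ y → ∀ z → (z ∈ y) ↔ (z ⊆ x)
      S4 : Σ D λ y → (Σ D λ z → IsSet z × z ∈ y × (∀ b → b ∉ z))
                   × (∀ x → x ∈ y → Σ D λ s → s ∈ y × (∀ c → (c ∈ s) ↔ (c ∈ x ⊎ c ≡ x)))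
      S5 : (φ : Formula 4) → ∀ c₁ c₂ x →
           (∀ a → a ∈ x → ∃! (λ b → ⟦ φ ⟧ (env4 a b c₁ c₂))) →
           Σ D λ y → IsSet y ×
             (∀ b → (b ∈ y) ↔ (Σ D λ a → a ∈ x × ⟦ φ ⟧ (env4 a b c₁ c₂)))
      S6 : ∀ x → IsSet x → x ≡∅ ⊎
           (Σ D λ a → a ∈ x × ¬ (Σ D λ b → b ∈ x × (b π₁ a ⊎ b π₂ a ⊎ b ∈ a)))
      P1 : ∀ p → Pair p → ∀ a → a ∉ p
      P2 : ∀ a b → Σ D λ p → a π₁ p × b π₂ p
      P3 : ∀ p → (Σ D λ a → a π₁ p) ↔ (Σ D λ b → b π₂ p)
      P4 : ∀ p → Pair p → ∃! (λ a → a π₁ p) × ∃! (λ b → b π₂ p)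
      P5 : ∀ p q → Pair p → Pair q →
           (∀ a → ((a π₁ p) ↔ (a π₁ q)) × ((a π₂ p) ↔ (a π₂ q))) → p ≡ q

  UnorderedPairing : Set
  UnorderedPairing = ∀ a b → Σ D λ x → ∀ c → (c ∈ x) ↔ (c ≡ a ⊎ c ≡ b)

  Specification : Set
  Specification = (φ : Formula 1) → ∀ x → IsSet x →
    Σ D λ y → IsSet y × (∀ a → (a ∈ y) ↔ (a ∈ x × ⟦ φ ⟧ (env1 a)))

  CartesianProduct : Set
  CartesianProduct = ∀ x y → IsSet x → IsSet y →
    Σ D λ z → IsSet z × (∀ p → (p ∈ z) ↔
      (Σ D λ a → a ∈ x × (Σ D λ b → b ∈ y × (a π₁ p × b π₂ p))))

{-# OPTIONS --safe #-}
-- Every construction is an instance of replacement (S5), which needs a formula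
-- defining a functional relation; `Definable` pairs a predicate on environments
-- with a formula expressing it, so formulas are assembled from their meanings.
--
-- Pairing: the set of the infinity axiom S4 contains ∅ and its successor, which
-- is non-empty; replace every empty member by a and every non-empty one by b.
-- Specification: if some a₀ ∈ x satisfies φ, replace each a ∈ x by a when φ a
-- holds and by a₀ otherwise; if none does, ∅ works.  Both case distinctions are
-- functional by excluded middle.  Product: the row x × {b} is the image of x
-- under a ↦ (a , b), functional by P4 and P5; rows are unique by extensionality,
-- so replacement over y collects them, and the union of that set, made a set by
-- an identity replacement, is x × y.  As S5 places no condition on its domain,
-- neither x nor y needs to be a set.
module Submission where

open import Defs
open import Level using (0ℓ)
open import Function using (_∘_; id)
open import Data.Nat using (ℕ; suc)
open import Data.Fin using (Fin; zero; suc; #_)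
open import Data.Product using (_×_; Σ; _,_; proj₁; proj₂) renaming (map to map-×)
open import Data.Sum using (_⊎_; inj₁; inj₂) renaming (map to map-⊎)
open import Data.Empty using (⊥-elim)
open import Relation.Nullary using (¬_; yes; no)
open import Relation.Binary.PropositionalEquality using (_≡_; _≗_; refl; sym; trans)
open import Axiom.ExcludedMiddle using (ExcludedMiddle)

ext : ∀ {n m} → (Fin n → Fin m) → Fin (suc n) → Fin (suc m)
ext r zero    = zero
ext r (suc i) = suc (r i)

renT : ∀ {n m} → (Fin n → Fin m) → Term n → Term m
renF : ∀ {n m} → (Fin n → Fin m) → Formula n → Formula m
renT r (var i)   = var (r i)
renT r (ι φ)     = ι (renF (ext r) φ)
renF r (t ∈' u)  = renT r t ∈' renT r u
renF r (t π₁' u) = renT r t π₁' renT r u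
renF r (t π₂' u) = renT r t π₂' renT r u
renF r (t ≐ u)   = renT r t ≐ renT r u
renF r ⊥'        = ⊥'
renF r (¬' φ)    = ¬' renF r φ
renF r (φ ∧' ψ)  = renF r φ ∧' renF r ψ
renF r (φ ∨' ψ)  = renF r φ ∨' renF r ψ
renF r (φ ⇒' ψ)  = renF r φ ⇒' renF r ψ
renF r (φ ⇔' ψ)  = renF r φ ⇔' renF r ψ
renF r (∀' φ)    = ∀' (renF (ext r) φ)
renF r (∃' φ)    = ∃' (renF (ext r) φ)

module Definability (M : Structure) where
  open Structure M
  open Semantics M

  private variable
    n m : ℕ
    A B C E : Set

  ↔-refl : A ↔ A
  ↔-refl = id , id

  ↔-sym : A ↔ B → B ↔ A
  ↔-sym (f , g) = g , f

  ↔-trans : A ↔ B → B ↔ C → A ↔ C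
  ↔-trans (f , g) (h , k) = h ∘ f , g ∘ k

  ¬-cong : A ↔ B → (¬ A) ↔ (¬ B)
  ¬-cong (f , g) = (_∘ g) , (_∘ f)

  ×-cong : A ↔ B → C ↔ E → (A × C) ↔ (B × E)
  ×-cong (f , g) (h , k) = map-× f h , map-× g k

  ⊎-cong : A ↔ B → C ↔ E → (A ⊎ C) ↔ (B ⊎ E)
  ⊎-cong (f , g) (h , k) = map-⊎ f h , map-⊎ g k

  →-cong : A ↔ B → C ↔ E → (A → C) ↔ (B → E)
  →-cong (f , g) (h , k) = (λ u → h ∘ u ∘ g) , (λ u → k ∘ u ∘ f)

  ↔-cong : A ↔ B → C ↔ E → (A ↔ C) ↔ (B ↔ E)
  ↔-cong A↔B C↔E = ×-cong (→-cong A↔B C↔E) (→-cong C↔E A↔B)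

  Π-cong : {P Q : D → Set} → (∀ d → P d ↔ Q d) → (∀ d → P d) ↔ (∀ d → Q d)
  Π-cong P↔Q = (λ u d → proj₁ (P↔Q d) (u d)) , (λ u d → proj₂ (P↔Q d) (u d))

  Σ-cong : {P Q : D → Set} → (∀ d → P d ↔ Q d) → (Σ D P) ↔ (Σ D Q)
  Σ-cong P↔Q = (λ (d , p) → d , proj₁ (P↔Q d) p) , (λ (d , q) → d , proj₂ (P↔Q d) q)

  ∃!-cong : {P Q : D → Set} → (∀ d → P d ↔ Q d) → ∃! P → ∃! Q
  ∃!-cong P↔Q (b , p , unique) =
    b , proj₁ (P↔Q b) p , λ b′ q → unique b′ (proj₂ (P↔Q b′) q)

  atom-cong : ∀ (R : D → D → Set) {t u : Term n} {t′ u′ : Term m} {ρ σ} →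
    (∀ d → Denotes t ρ d ↔ Denotes t′ σ d) → (∀ e → Denotes u ρ e ↔ Denotes u′ σ e) →
    atom R t u ρ ↔ atom R t′ u′ σ
  atom-cong R t↔t′ u↔u′ = Σ-cong λ d → Σ-cong λ e → ×-cong (t↔t′ d) (×-cong (u↔u′ e) ↔-refl)

  atom-var : ∀ (R : D → D → Set) (i j : Fin n) ρ → atom R (var i) (var j) ρ ↔ R (ρ i) (ρ j)
  atom-var R i j ρ = (λ { (_ , _ , refl , refl , r) → r }) , (λ r → _ , _ , refl , refl , r)

  ext-≗ : ∀ {r : Fin n → Fin m} {ρ σ} d → ρ ∘ r ≗ σ → (d ∷ₑ ρ) ∘ ext r ≗ (d ∷ₑ σ)
  ext-≗ d ρr≗σ zero    = refl
  ext-≗ d ρr≗σ (suc i) = ρr≗σ i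

  renT-sound : ∀ (r : Fin n → Fin m) {ρ σ} → ρ ∘ r ≗ σ →
    ∀ t d → Denotes (renT r t) ρ d ↔ Denotes t σ d
  renF-sound : ∀ (r : Fin n → Fin m) {ρ σ} → ρ ∘ r ≗ σ →
    ∀ φ → ⟦ renF r φ ⟧ ρ ↔ ⟦ φ ⟧ σ

  renT-sound r ρr≗σ (var i) d = trans (sym (ρr≗σ i)) , trans (ρr≗σ i)
  renT-sound r ρr≗σ (ι φ)   d = ×-cong (body d) (Π-cong λ e → →-cong (body e) ↔-refl)
    where body = λ e → renF-sound (ext r) (ext-≗ e ρr≗σ) φ

  renF-sound r ρr≗σ (t ∈' u)  = atom-cong _∈_  (renT-sound r ρr≗σ t) (renT-sound r ρr≗σ u)
  renF-sound r ρr≗σ (t π₁' u) = atom-cong _π₁_ (renT-sound r ρr≗σ t) (renT-sound r ρr≗σ u)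
  renF-sound r ρr≗σ (t π₂' u) = atom-cong _π₂_ (renT-sound r ρr≗σ t) (renT-sound r ρr≗σ u)
  renF-sound r ρr≗σ (t ≐ u)   = atom-cong _≡_  (renT-sound r ρr≗σ t) (renT-sound r ρr≗σ u)
  renF-sound r ρr≗σ ⊥'        = ↔-refl
  renF-sound r ρr≗σ (¬' φ)    = ¬-cong (renF-sound r ρr≗σ φ)
  renF-sound r ρr≗σ (φ ∧' ψ)  = ×-cong (renF-sound r ρr≗σ φ) (renF-sound r ρr≗σ ψ)
  renF-sound r ρr≗σ (φ ∨' ψ)  = ⊎-cong (renF-sound r ρr≗σ φ) (renF-sound r ρr≗σ ψ)
  renF-sound r ρr≗σ (φ ⇒' ψ)  = →-cong (renF-sound r ρr≗σ φ) (renF-sound r ρr≗σ ψ)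
  renF-sound r ρr≗σ (φ ⇔' ψ)  = ↔-cong (renF-sound r ρr≗σ φ) (renF-sound r ρr≗σ ψ)
  renF-sound r ρr≗σ (∀' φ)    = Π-cong λ d → renF-sound (ext r) (ext-≗ d ρr≗σ) φ
  renF-sound r ρr≗σ (∃' φ)    = Σ-cong λ d → renF-sound (ext r) (ext-≗ d ρr≗σ) φ

  Definable : (Env M n → Set) → Set
  Definable {n} P = Σ (Formula n) λ φ → ∀ ρ → ⟦ φ ⟧ ρ ↔ P ρ

  ∈-definable : (i j : Fin n) → Definable (λ ρ → ρ i ∈ ρ j)
  ∈-definable i j = var i ∈' var j , atom-var _∈_ i j

  π₁-definable : (i j : Fin n) → Definable (λ ρ → ρ i π₁ ρ j)
  π₁-definable i j = var i π₁' var j , atom-var _π₁_ i j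

  π₂-definable : (i j : Fin n) → Definable (λ ρ → ρ i π₂ ρ j)
  π₂-definable i j = var i π₂' var j , atom-var _π₂_ i j

  ≡-definable : (i j : Fin n) → Definable (λ ρ → ρ i ≡ ρ j)
  ≡-definable i j = var i ≐ var j , atom-var _≡_ i j

  ¬-definable : {P : Env M n → Set} → Definable P → Definable (λ ρ → ¬ P ρ)
  ¬-definable (φ , φ↔P) = ¬' φ , λ ρ → ¬-cong (φ↔P ρ)

  ×-definable : {P Q : Env M n → Set} → Definable P → Definable Q → Definable (λ ρ → P ρ × Q ρ)
  ×-definable (φ , φ↔P) (ψ , ψ↔Q) = φ ∧' ψ , λ ρ → ×-cong (φ↔P ρ) (ψ↔Q ρ)

  ⊎-definable : {P Q : Env M n → Set} → Definable P → Definable Q → Definable (λ ρ → P ρ ⊎ Q ρ)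
  ⊎-definable (φ , φ↔P) (ψ , ψ↔Q) = φ ∨' ψ , λ ρ → ⊎-cong (φ↔P ρ) (ψ↔Q ρ)

  ↔-definable : {P Q : Env M n → Set} → Definable P → Definable Q → Definable (λ ρ → P ρ ↔ Q ρ)
  ↔-definable (φ , φ↔P) (ψ , ψ↔Q) = φ ⇔' ψ , λ ρ → ↔-cong (φ↔P ρ) (ψ↔Q ρ)

  Π-definable : {P : Env M (suc n) → Set} → Definable P → Definable (λ ρ → ∀ d → P (d ∷ₑ ρ))
  Π-definable (φ , φ↔P) = ∀' φ , λ ρ → Π-cong λ d → φ↔P (d ∷ₑ ρ)

  Σ-definable : {P : Env M (suc n) → Set} → Definable P → Definable (λ ρ → Σ D λ d → P (d ∷ₑ ρ))
  Σ-definable (φ , φ↔P) = ∃' φ , λ ρ → Σ-cong λ d → φ↔P (d ∷ₑ ρ)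

  Cases : Set → D → D → D → Set
  Cases A u v b = (A × b ≡ u) ⊎ (¬ A × b ≡ v)

  Cases⇒≡⊎≡ : ∀ {u v b} → Cases A u v b → b ≡ u ⊎ b ≡ v
  Cases⇒≡⊎≡ = map-⊎ proj₂ proj₂

  Cases-definable : {P : Env M n → Set} → Definable P → (i j k : Fin n) →
    Definable (λ ρ → Cases (P ρ) (ρ j) (ρ k) (ρ i))
  Cases-definable P-def i j k =
    ⊎-definable (×-definable P-def (≡-definable i j))
                (×-definable (¬-definable P-def) (≡-definable i k))

  ∃!-Cases : ExcludedMiddle 0ℓ → ∀ A u v → ∃! (Cases A u v)
  ∃!-Cases lem A u v with lem {A}
  ... | yes a = u , inj₁ (a , refl) ,
    λ { _ (inj₁ (_ , b≡u)) → b≡u ; _ (inj₂ (¬a , _)) → ⊥-elim (¬a a) }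
  ... | no ¬a = v , inj₂ (¬a , refl) ,
    λ { _ (inj₁ (a , _)) → ⊥-elim (¬a a) ; _ (inj₂ (_ , b≡v)) → b≡v }

module Consequences (M : Structure) (zfp : Semantics.ZFP M) where
  open Structure M
  open Semantics M
  open ZFP zfp
  open Definability M

  Empty : D → Set
  Empty a = ∀ d → d ∉ a

  Empty-definable : ∀ {n} → Definable {suc n} (λ ρ → Empty (ρ zero))
  Empty-definable = Π-definable (¬-definable (∈-definable zero (suc zero)))

  replacement : {P : Env M 4 → Set} → Definable P → ∀ c₁ c₂ x →
    (∀ a → a ∈ x → ∃! (λ b → P (env4 a b c₁ c₂))) →
    Σ D λ y → IsSet y × (∀ b → (b ∈ y) ↔ (Σ D λ a → a ∈ x × P (env4 a b c₁ c₂)))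
  replacement (φ , φ↔P) c₁ c₂ x functional
    with S5 φ c₁ c₂ x (λ a a∈x → ∃!-cong (λ b → ↔-sym (φ↔P (env4 a b c₁ c₂))) (functional a a∈x))
  ... | y , y-set , y-mem =
    y , y-set , λ b → ↔-trans (y-mem b) (Σ-cong λ a → ×-cong ↔-refl (φ↔P (env4 a b c₁ c₂)))

  emptySet : Σ D λ z → IsSet z × Empty z
  emptySet = let (_ , (z , z-set , _ , z-empty) , _) = S4 in z , z-set , z-empty

  emptyAndNonEmptyMembers :
    Σ D λ t → (Σ D λ e → e ∈ t × Empty e) × (Σ D λ s → s ∈ t × ¬ Empty s)
  emptyAndNonEmptyMembers =
    let (t , (z , _ , z∈t , z-empty) , successor) = S4
        (s , s∈t , s-mem) = successor z z∈t
    in t , (z , z∈t , z-empty) , (s , s∈t , λ s-empty → s-empty z (proj₂ (s-mem z) (inj₂ refl)))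

  pairing : ExcludedMiddle 0ℓ → UnorderedPairing
  pairing lem a b
    with emptyAndNonEmptyMembers
  ... | t , (e , e∈t , e-empty) , (s , s∈t , s-nonempty)
    with replacement (Cases-definable Empty-definable (# 1) (# 2) (# 3)) a b t
                     (λ w _ → ∃!-Cases lem (Empty w) a b)
  ... | x , _ , x-mem = x , λ c →
    Cases⇒≡⊎≡ ∘ proj₂ ∘ proj₂ ∘ proj₁ (x-mem c) ,
    λ { (inj₁ c≡a) → proj₂ (x-mem c) (e , e∈t , inj₁ (e-empty , c≡a))
      ; (inj₂ c≡b) → proj₂ (x-mem c) (s , s∈t , inj₂ (s-nonempty , c≡b)) }

  specification : ExcludedMiddle 0ℓ → (φ : Formula 1) → ∀ x →
    Σ D λ y → IsSet y × (∀ a → (a ∈ y) ↔ (a ∈ x × ⟦ φ ⟧ (env1 a)))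
  specification lem φ x with lem {Σ D λ a → a ∈ x × ⟦ φ ⟧ (env1 a)}
  ... | no none =
    let (z , z-set , z-empty) = emptySet
    in z , z-set , λ a → ⊥-elim ∘ z-empty a , λ (a∈x , φa) → ⊥-elim (none (a , a∈x , φa))
  ... | yes (a₀ , a₀∈x , φa₀)
    with replacement (Cases-definable φ-definable (# 1) (# 0) (# 2)) a₀ a₀ x
                     (λ w _ → ∃!-Cases lem (⟦ φ ⟧ (env1 w)) w a₀)
    where
    φ-definable : Definable {4} (λ ρ → ⟦ φ ⟧ (env1 (ρ zero)))
    φ-definable = renF (λ _ → zero) φ , λ ρ → renF-sound (λ _ → zero) (λ { zero → refl }) φ
  ... | y , y-set , y-mem = y , y-set , λ a →
    (λ a∈y → kept (proj₁ (y-mem a) a∈y)) ,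
    (λ (a∈x , φa) → proj₂ (y-mem a) (a , a∈x , inj₁ (φa , refl)))
    where
    kept : ∀ {a} → (Σ D λ w → w ∈ x × Cases (⟦ φ ⟧ (env1 w)) w a₀ a) → a ∈ x × ⟦ φ ⟧ (env1 a)
    kept (w , w∈x , inj₁ (φw , refl)) = w∈x , φw
    kept (_ , _   , inj₂ (_  , refl)) = a₀∈x , φa₀

  π₁-unique : ∀ {a p} → a π₁ p → ∀ c → (c π₁ p) ↔ (c ≡ a)
  π₁-unique {a} {p} a-π₁ c =
    let (_ , _ , unique) = proj₁ (P4 p (a , a-π₁))
    in (λ c-π₁ → trans (unique c c-π₁) (sym (unique a a-π₁))) , λ { refl → a-π₁ }

  π₂-unique : ∀ {a b p} → a π₁ p → b π₂ p → ∀ c → (c π₂ p) ↔ (c ≡ b)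
  π₂-unique {a} {b} {p} a-π₁ b-π₂ c =
    let (_ , _ , unique) = proj₂ (P4 p (a , a-π₁))
    in (λ c-π₂ → trans (unique c c-π₂) (sym (unique b b-π₂))) , λ { refl → b-π₂ }

  pair-unique : ∀ {a b p q} → a π₁ p → b π₂ p → a π₁ q → b π₂ q → p ≡ q
  pair-unique {a} a-π₁p b-π₂p a-π₁q b-π₂q = P5 _ _ (a , a-π₁p) (a , a-π₁q) λ c →
    ↔-trans (π₁-unique a-π₁p c) (↔-sym (π₁-unique a-π₁q c)) ,
    ↔-trans (π₂-unique a-π₁p b-π₂p c) (↔-sym (π₂-unique a-π₁q b-π₂q c))

  ∃!-pair : ∀ a b → ∃! (λ p → a π₁ p × b π₂ p)
  ∃!-pair a b = let (p , a-π₁ , b-π₂) = P2 a b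
    in p , (a-π₁ , b-π₂) , λ q (a-π₁q , b-π₂q) → pair-unique a-π₁q b-π₂q a-π₁ b-π₂

  IsRow : D → D → D → Set
  IsRow x b z = IsSet z × (∀ p → (p ∈ z) ↔ (Σ D λ a → a ∈ x × (a π₁ p × b π₂ p)))

  IsRow-definable : Definable {4} (λ ρ → IsRow (ρ (# 2)) (ρ (# 0)) (ρ (# 1)))
  -- Read at env4 b z x _; each binder shifts the de Bruijn indices by one.
  IsRow-definable =
    ×-definable (¬-definable (Σ-definable (π₁-definable (# 0) (# 2))))
      (Π-definable (↔-definable (∈-definable (# 0) (# 2))
        (Σ-definable (×-definable (∈-definable (# 0) (# 4))
          (×-definable (π₁-definable (# 0) (# 1)) (π₂-definable (# 2) (# 1)))))))

  row : ∀ x b → Σ D (IsRow x b)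
  row x b = replacement (×-definable (π₁-definable (# 0) (# 1)) (π₂-definable (# 2) (# 1)))
                        b b x (λ a _ → ∃!-pair a b)

  ∃!-row : ∀ x b → ∃! (IsRow x b)
  ∃!-row x b = let (z , z-set , z-mem) = row x b
    in z , (z-set , z-mem) , λ z′ (z′-set , z′-mem) →
         S1 z′ z z′-set z-set λ p → ↔-trans (z′-mem p) (↔-sym (z-mem p))

  setWithSameMembers : ∀ u → Σ D λ v → IsSet v × (∀ c → (c ∈ v) ↔ (c ∈ u))
  setWithSameMembers u
    with replacement (≡-definable (# 1) (# 0)) u u u (λ a _ → a , refl , λ _ b≡a → b≡a)
  ... | v , v-set , v-mem =
    v , v-set , λ c →
      (λ { (_ , c∈u , refl) → c∈u }) ∘ proj₁ (v-mem c) ,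
      (λ c∈u → proj₂ (v-mem c) (c , c∈u , refl))

  union : ∀ w → IsSet w → Σ D λ v → IsSet v × (∀ c → (c ∈ v) ↔ (Σ D λ z → z ∈ w × c ∈ z))
  union w w-set = let (u , u-mem) = S2 w w-set
                      (v , v-set , v-mem) = setWithSameMembers u
    in v , v-set , λ c → ↔-trans (v-mem c) (u-mem c)

  product : ∀ x y → Σ D λ z → IsSet z × (∀ p → (p ∈ z) ↔
    (Σ D λ a → a ∈ x × (Σ D λ b → b ∈ y × (a π₁ p × b π₂ p))))
  product x y
    with replacement IsRow-definable x x y (λ b _ → ∃!-row x b)
  ... | rows , rows-set , rows-mem
    with union rows rows-set
  ... | z , z-set , z-mem = z , z-set , λ p →
    (λ p∈z → fromRow (proj₁ (z-mem p) p∈z)) ,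
    (λ (a , a∈x , b , b∈y , a-π₁ , b-π₂) →
      let (r , r-row) = row x b
      in proj₂ (z-mem p) (r , proj₂ (rows-mem r) (b , b∈y , r-row) ,
                          proj₂ (proj₂ r-row p) (a , a∈x , a-π₁ , b-π₂)))
    where
    fromRow : ∀ {p} → (Σ D λ r → r ∈ rows × p ∈ r) →
      Σ D λ a → a ∈ x × (Σ D λ b → b ∈ y × (a π₁ p × b π₂ p))
    fromRow {p} (r , r∈rows , p∈r) =
      let (b , b∈y , (_ , r-mem)) = proj₁ (rows-mem r) r∈rows
          (a , a∈x , a-π₁ , b-π₂) = proj₁ (r-mem p) p∈r
      in a , a∈x , b , b∈y , a-π₁ , b-π₂

lemma2 : ExcludedMiddle 0ℓ → (M : Structure) → Semantics.ZFP M →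
    Semantics.UnorderedPairing M × Semantics.Specification M × Semantics.CartesianProduct M
lemma2 lem M zfp =
  pairing lem , (λ φ x _ → specification lem φ x) , (λ x y _ _ → product x y)
  where open Consequences M zfp
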